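{- Let $n\ge1$, $\pi\in B_n$, and let $a,b,c$ be distinct elements of $\pi[n]$. Then (a) $e(a,b)+e(a,c)+e(b,c)\le 2$, and (b) $e(a,-b)+e(a,-c)+e(b,-c)\le 2$.
   Context: $B_n$ is the group of permutations $\pi$ of $[-n,n]\setminus\{0\}$ with $\pi(-i)=-\pi(i)$; $\pi[n]=\{\pi(1),\dots,\pi(n)\}$. Let $\ell$ be the length with respect to the generators $s_0=t_{1,-1}$, $s_i=t_{i,i+1}t_{ -i,-(i+1)}$ ($1\le i\le n-1$), $t_{x,y}$ the transposition of $x,y$. For distinct $x,y\in[-n,n]\setminus\{0\}$ define $u_{x,y}$: if $x=-y$, $u_{x,y}=t_{x,-x}$; if $xy>0$ or $\pi^{ -1}(x)\pi^{ -1}(y)>0$, $u_{x,y}=t_{x,y}t_{ -x,-y}$; otherwise $u_{x,y}$ is undefined. The graph $\Gamma_-^B(\pi)$ has vertex set $[-n,n]\setminus\{0\}$, with $\{x,y\}$ an edge iff $u_{x,y}$ is defined and $\ell(u_{x,y}\pi)=\ell(\pi)-1$. Set $e(x,y)=1$ if $x,y$ are adjacent in $\Gamma_-^B(\pi)$ and $e(x,y)=0$ otherwise; $e(x,x)=0$. -}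

module Defs where

open import Data.Nat using (ℕ; zero; suc; _≤_)
open import Data.Fin using (Fin; zero; suc; inject₁)
open import Data.Fin.Properties using () renaming (_≟_ to _≟ᶠ_)
open import Data.Bool using (Bool; true; false; not)
open import Data.Bool.Properties using () renaming (_≟_ to _≟ᵇ_)
open import Data.Product using (Σ; ∃; _×_; _,_; proj₁; proj₂)
open import Data.Product.Properties using (≡-dec)
open import Data.Sum using (_⊎_)
open import Data.List using (List; []; _∷_; length)
open import Function using (_∘_; id)
open import Relation.Binary.PropositionalEquality using (_≡_; _≢_)
open import Relation.Nullary using (Dec; yes; no)

-- Signed elements of [-n,n]∖{0}: (s , i) stands for ±(i+1),
-- with s = false meaning positive and s = true meaning negative.
SElem : ℕ → Set
SElem n = Bool × Fin n

neg : ∀ {n} → SElem n → SElem n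
neg (s , i) = (not s , i)

pos : ∀ {n} → Fin n → SElem n
pos i = (false , i)

sign : ∀ {n} → SElem n → Bool
sign = proj₁

_≟ₛ_ : ∀ {n} (x y : SElem n) → Dec (x ≡ y)
_≟ₛ_ = ≡-dec _≟ᵇ_ _≟ᶠ_

record BPerm (n : ℕ) : Set where
  field
    fun    : SElem n → SElem n
    inv    : SElem n → SElem n
    left   : ∀ x → inv (fun x) ≡ x
    right  : ∀ x → fun (inv x) ≡ x
    odd    : ∀ x → fun (neg x) ≡ neg (fun x)
open BPerm public

transp : ∀ {n} → SElem n → SElem n → SElem n → SElem n
transp x y z with z ≟ₛ x
... | yes _ = y
... | no _ with z ≟ₛ y
...   | yes _ = x
...   | no _ = z

-- Coxeter generators of B_n, indexed by Fin n:
-- index 0 is s_0 = t_{1,-1}; index j+1 is s_{j+1} = t_{j+1,j+2} t_{-(j+1),-(j+2)}.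
gen : ∀ {n} → Fin n → SElem n → SElem n
gen {suc m} zero = transp (pos zero) (neg (pos zero))
gen {suc m} (suc j) =
  transp (pos (inject₁ j)) (pos (suc j)) ∘ transp (neg (pos (inject₁ j))) (neg (pos (suc j)))

evalW : ∀ {n} → List (Fin n) → SElem n → SElem n
evalW [] = id
evalW (k ∷ w) = gen k ∘ evalW w

Represents : ∀ {n} → List (Fin n) → (SElem n → SElem n) → Set
Represents w f = ∀ x → evalW w x ≡ f x

HasLength : ∀ {n} → (SElem n → SElem n) → ℕ → Set
HasLength {n} f k =
  (∃ λ (w : List (Fin n)) → length w ≡ k × Represents w f)
  × (∀ (w : List (Fin n)) → Represents w f → k ≤ length w)

-- the map u_{x,y} (meaningful only when u_{x,y} is defined)
u : ∀ {n} → SElem n → SElem n → SElem n → SElem n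
u x y with x ≟ₛ neg y
... | yes _ = transp x (neg x)
... | no _ = transp x y ∘ transp (neg x) (neg y)

UDefined : ∀ {n} → BPerm n → SElem n → SElem n → Set
UDefined π x y =
  x ≡ neg y ⊎ sign x ≡ sign y ⊎ sign (inv π x) ≡ sign (inv π y)

Edge : ∀ {n} → BPerm n → SElem n → SElem n → Set
Edge π x y =
  x ≢ y × UDefined π x y
  × ∃ λ k → HasLength (fun π) (suc k) × HasLength (u x y ∘ fun π) k

InImage : ∀ {n} → BPerm n → SElem n → Set
InImage {n} π x = ∃ λ (i : Fin n) → fun π (pos i) ≡ x

-- Let D π = inv π + neg π, where inv counts the inversions of π as a permutation of the ordered set
-- -n < … < -1 < 1 < … < n and neg counts the i > 0 with π i < 0. Each generator s_i changes D by ±2,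
-- and some s_i lowers it unless π = id; hence D = 2ℓ. The effect of u_{x,y} on D is computed locally:
-- only the pairs of positions meeting ±π⁻¹ x, ±π⁻¹ y contribute to the change.
-- (a) For a = π p and b = π q, u_{a,b} lowers D by exactly 2 only if (p , q) is an inversion and no
-- position strictly between p and q carries a value strictly between a and b. In a triangle of edges
-- the middle value sits between the outer two, in position and in value.
-- (b) u_{a,-b} is defined only if a and b have opposite signs, which cannot hold for all three pairs.
module Submission where

open import Defs
open import Data.Bool using (Bool; true; false; not; T; _∧_; _∨_; if_then_else_)
open import Data.Bool.Properties using (not-involutive; not-injective; not-¬; ¬-not) renaming (_≟_ to _≟ᵇ_)
open import Data.Empty using (⊥; ⊥-elim)
open import Data.Fin using (Fin; zero; suc; toℕ; inject₁; fromℕ)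
open import Data.Fin.Induction using (<-weakInduction; >-weakInduction)
open import Data.Fin.Properties using (toℕ-injective; suc-injective; toℕ-inject₁; toℕ-fromℕ; toℕ≤pred[n]; any?)
open import Data.List using (List; []; _∷_; map; length)
open import Data.List.Relation.Unary.All as All using (All; []; _∷_)
open import Data.List.Relation.Unary.AllPairs using ([]; _∷_)
open import Data.List.Relation.Unary.Any using (here; there)
open import Data.List.Relation.Unary.Unique.Propositional using (Unique)
open import Data.Nat using (ℕ; zero; suc; _+_; _*_; _≤_; _<_; _<ᵇ_; z≤n; s≤s)
open import Data.Nat.Properties as ℕ using (<ᵇ⇒<)
open import Algebra.Properties.CommutativeMonoid.Sum ℕ.+-0-commutativeMonoid using (sum; sum-cong-≗; ∑-distrib-+)
open import Data.Nat.Tactic.RingSolver using (solve-∀)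
open import Data.Product using (Σ; _×_; _,_; proj₁; proj₂)
open import Data.Sum using (inj₁; inj₂)
open import Data.Unit using (tt)
open import Function using (_∘_; id)
open import Relation.Binary.PropositionalEquality
open import Relation.Nullary using (¬_; yes; no; does)

<ᵇ-irrefl : ∀ n → (n <ᵇ n) ≡ false
<ᵇ-irrefl zero = refl
<ᵇ-irrefl (suc n) = <ᵇ-irrefl n

<ᵇ-trans : ∀ l m n → (l <ᵇ m) ≡ true → (m <ᵇ n) ≡ true → (l <ᵇ n) ≡ true
<ᵇ-trans zero (suc m) (suc n) _ _ = refl
<ᵇ-trans (suc l) (suc m) (suc n) p q = <ᵇ-trans l m n p q

<ᵇ-flip : ∀ m n → m ≢ n → (n <ᵇ m) ≡ not (m <ᵇ n)
<ᵇ-flip zero zero m≢n = ⊥-elim (m≢n refl)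
<ᵇ-flip zero (suc n) _ = refl
<ᵇ-flip (suc m) zero _ = refl
<ᵇ-flip (suc m) (suc n) m≢n = <ᵇ-flip m n (m≢n ∘ cong suc)

<ᵇ-asym : ∀ {m n} → (m <ᵇ n) ≡ true → (n <ᵇ m) ≡ false
<ᵇ-asym {zero} {suc n} _ = refl
<ᵇ-asym {suc m} {suc n} m<n = <ᵇ-asym {m} {n} m<n

<ᵇ-true⇒< : ∀ {m n} → (m <ᵇ n) ≡ true → m < n
<ᵇ-true⇒< {m} {n} m<ᵇn = <ᵇ⇒< m n (subst T (sym m<ᵇn) tt)

n<ᵇ1+n : ∀ n → (n <ᵇ suc n) ≡ true
n<ᵇ1+n zero = refl
n<ᵇ1+n (suc n) = n<ᵇ1+n n

1+n<ᵇn : ∀ n → (suc n <ᵇ n) ≡ false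
1+n<ᵇn zero = refl
1+n<ᵇn (suc n) = 1+n<ᵇn n

<ᵇ-adjacent : ∀ t a → t ≢ a → t ≢ suc a →
  ((a <ᵇ t) ≡ (suc a <ᵇ t)) × ((t <ᵇ a) ≡ (t <ᵇ suc a))
<ᵇ-adjacent zero zero t≢a _ = ⊥-elim (t≢a refl)
<ᵇ-adjacent zero (suc a) _ _ = refl , refl
<ᵇ-adjacent (suc zero) zero _ t≢1+a = ⊥-elim (t≢1+a refl)
<ᵇ-adjacent (suc (suc t)) zero _ _ = refl , refl
<ᵇ-adjacent (suc t) (suc a) t≢a t≢1+a = <ᵇ-adjacent t a (t≢a ∘ cong suc) (t≢1+a ∘ cong suc)

-- The order -n < … < -1 < 1 < … < n on signed elements

_<ₛ_ : ∀ {n} → SElem n → SElem n → Bool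
(false , i) <ₛ (false , j) = toℕ i <ᵇ toℕ j
(false , _) <ₛ (true , _) = false
(true , _) <ₛ (false , _) = true
(true , i) <ₛ (true , j) = toℕ j <ᵇ toℕ i

<ₛ-irrefl : ∀ {n} (x : SElem n) → (x <ₛ x) ≡ false
<ₛ-irrefl (false , i) = <ᵇ-irrefl (toℕ i)
<ₛ-irrefl (true , i) = <ᵇ-irrefl (toℕ i)

<ₛ-neg : ∀ {n} (x y : SElem n) → (neg x <ₛ neg y) ≡ (y <ₛ x)
<ₛ-neg (false , _) (false , _) = refl
<ₛ-neg (false , _) (true , _) = refl
<ₛ-neg (true , _) (false , _) = refl
<ₛ-neg (true , _) (true , _) = refl

<ₛ-trans : ∀ {n} {x y z : SElem n} → (x <ₛ y) ≡ true → (y <ₛ z) ≡ true → (x <ₛ z) ≡ true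
<ₛ-trans {x = false , i} {false , j} {false , k} = <ᵇ-trans (toℕ i) (toℕ j) (toℕ k)
<ₛ-trans {x = true , _} {_} {false , _} _ _ = refl
<ₛ-trans {x = true , i} {true , j} {true , k} p q = <ᵇ-trans (toℕ k) (toℕ j) (toℕ i) q p

<ₛ-flip : ∀ {n} (x y : SElem n) → x ≢ y → (y <ₛ x) ≡ not (x <ₛ y)
<ₛ-flip (false , i) (false , j) x≢y = <ᵇ-flip (toℕ i) (toℕ j) (x≢y ∘ cong (false ,_) ∘ toℕ-injective)
<ₛ-flip (false , _) (true , _) _ = refl
<ₛ-flip (true , _) (false , _) _ = refl
<ₛ-flip (true , i) (true , j) x≢y = <ᵇ-flip (toℕ j) (toℕ i) (x≢y ∘ cong (true ,_) ∘ sym ∘ toℕ-injective)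

<ₛ⇒≢ : ∀ {n} {x y : SElem n} → (x <ₛ y) ≡ true → x ≢ y
<ₛ⇒≢ {x = x} x<y refl with trans (sym (<ₛ-irrefl x)) x<y
... | ()

<ₛ-asym : ∀ {n} (x y : SElem n) → (x <ₛ y) ≡ true → (y <ₛ x) ≡ false
<ₛ-asym x y x<y = trans (<ₛ-flip x y (<ₛ⇒≢ x<y)) (cong not x<y)

≮ₛ⇒>ₛ : ∀ {n} {x y : SElem n} → x ≢ y → (x <ₛ y) ≡ false → (y <ₛ x) ≡ true
≮ₛ⇒>ₛ {x = x} {y} x≢y x≮y = trans (<ₛ-flip x y x≢y) (cong not x≮y)

-- Finite sums

sum-≥ : ∀ {n} (f : Fin n → ℕ) (j : Fin n) → f j ≤ sum f
sum-≥ f zero = ℕ.m≤m+n _ _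
sum-≥ f (suc j) = ℕ.≤-trans (sum-≥ (f ∘ suc) j) (ℕ.m≤n+m _ _)

sum-zero : ∀ {n} {f : Fin n → ℕ} → (∀ i → f i ≡ 0) → sum f ≡ 0
sum-zero {zero} _ = refl
sum-zero {suc n} f≡0 rewrite f≡0 zero = sum-zero (f≡0 ∘ suc)

sum-point : ∀ {n} {f : Fin n → ℕ} (j : Fin n) → (∀ i → i ≢ j → f i ≡ 0) → sum f ≡ f j
sum-point {f = f} zero f≡0 rewrite sum-zero (λ i → f≡0 (suc i) λ ()) = ℕ.+-identityʳ (f zero)
sum-point (suc j) f≡0 rewrite f≡0 zero (λ ()) = sum-point j (λ i i≢j → f≡0 (suc i) (i≢j ∘ suc-injective))

ΣS : ∀ {n} → (SElem n → ℕ) → ℕ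
ΣS f = sum (λ i → f (false , i) + f (true , i))

ΣS-cong : ∀ {n} {f g : SElem n → ℕ} → (∀ x → f x ≡ g x) → ΣS f ≡ ΣS g
ΣS-cong {n} f≗g = sum-cong-≗ {n} (λ i → cong₂ _+_ (f≗g _) (f≗g _))

ΣS-+ : ∀ {n} (f g : SElem n → ℕ) → ΣS (λ x → f x + g x) ≡ ΣS f + ΣS g
ΣS-+ f g = trans (sum-cong-≗ λ i → interchange (f (false , i)) (g (false , i)) (f (true , i)) (g (true , i)))
                 (∑-distrib-+ (λ i → f (false , i) + f (true , i)) (λ i → g (false , i) + g (true , i)))
  where
  interchange : ∀ a b c d → (a + b) + (c + d) ≡ (a + c) + (b + d)
  interchange = solve-∀

ΣS-zero : ∀ {n} {f : SElem n → ℕ} → (∀ x → f x ≡ 0) → ΣS f ≡ 0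
ΣS-zero {n} f≡0 = sum-zero {n} (λ i → cong₂ _+_ (f≡0 _) (f≡0 _))

ΣS-≥ : ∀ {n} (f : SElem n → ℕ) (c : SElem n) → f c ≤ ΣS f
ΣS-≥ f (false , j) = ℕ.≤-trans (ℕ.m≤m+n _ _) (sum-≥ (λ i → f (false , i) + f (true , i)) j)
ΣS-≥ f (true , j) = ℕ.≤-trans (ℕ.m≤n+m _ _) (sum-≥ (λ i → f (false , i) + f (true , i)) j)

ΣS-point : ∀ {n} {f : SElem n → ℕ} (c : SElem n) → (∀ x → x ≢ c → f x ≡ 0) → ΣS f ≡ f c
ΣS-point {n} {f} (false , j) f≡0 =
  trans (sum-point {n} j (λ i i≢j → cong₂ _+_ (f≡0 _ (i≢j ∘ cong proj₂)) (f≡0 _ λ ())))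
        (trans (cong (f (false , j) +_) (f≡0 _ λ ())) (ℕ.+-identityʳ _))
ΣS-point {n} {f} (true , j) f≡0 =
  trans (sum-point {n} j (λ i i≢j → cong₂ _+_ (f≡0 _ λ ()) (f≡0 _ (i≢j ∘ cong proj₂))))
        (cong (_+ f (true , j)) (f≡0 _ λ ()))

sumL : ∀ {A : Set} → (A → ℕ) → List A → ℕ
sumL G [] = 0
sumL G (c ∷ L) = G c + sumL G L

sumL-map : ∀ {A B : Set} (G : B → ℕ) (φ : A → B) L → sumL G (map φ L) ≡ sumL (G ∘ φ) L
sumL-map G φ [] = refl
sumL-map G φ (c ∷ L) = cong (G (φ c) +_) (sumL-map G φ L)

sumL-cong : ∀ {A : Set} {G H : A → ℕ} {L} → All (λ c → G c ≡ H c) L → sumL G L ≡ sumL H L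
sumL-cong [] = refl
sumL-cong (Gc≡Hc ∷ G≗H) = cong₂ _+_ Gc≡Hc (sumL-cong G≗H)

_∈ᵇ_ : ∀ {n} → SElem n → List (SElem n) → Bool
x ∈ᵇ [] = false
x ∈ᵇ (c ∷ L) = does (x ≟ₛ c) ∨ x ∈ᵇ L

∉ᵇ⇒All≢ : ∀ {n} {r : SElem n} L → (r ∈ᵇ L) ≡ false → All (r ≢_) L
∉ᵇ⇒All≢ [] _ = []
∉ᵇ⇒All≢ {r = r} (c ∷ L) r∉ with r ≟ₛ c
... | no r≢c = r≢c ∷ ∉ᵇ⇒All≢ L r∉

All≢⇒∉ᵇ : ∀ {n} {r : SElem n} {L} → All (r ≢_) L → (r ∈ᵇ L) ≡ false
All≢⇒∉ᵇ [] = refl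
All≢⇒∉ᵇ {r = r} {c ∷ _} (r≢c ∷ r≢L) with r ≟ₛ c
... | yes r≡c = ⊥-elim (r≢c r≡c)
... | no _ = All≢⇒∉ᵇ r≢L

outside : ∀ {n} → List (SElem n) → (SElem n → ℕ) → SElem n → ℕ
outside L G r = if r ∈ᵇ L then 0 else G r

outside-cong : ∀ {n} (L : List (SElem n)) {G H : SElem n → ℕ} →
  (∀ r → (r ∈ᵇ L) ≡ false → G r ≡ H r) → ∀ r → outside L G r ≡ outside L H r
outside-cong L G≗H r with r ∈ᵇ L in r∉
... | true = refl
... | false = G≗H r r∉

outside-+ : ∀ {n} (L : List (SElem n)) (G H : SElem n → ℕ) r →
  outside L G r + outside L H r ≡ outside L (λ x → G x + H x) r
outside-+ L G H r with r ∈ᵇ L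
... | true = refl
... | false = refl

ΣS-outside-0 : ∀ {n} (L : List (SElem n)) → ΣS (outside L (λ _ → 0)) ≡ 0
ΣS-outside-0 L = ΣS-zero zero-everywhere
  where
  zero-everywhere : ∀ r → outside L (λ _ → 0) r ≡ 0
  zero-everywhere r with r ∈ᵇ L
  ... | true = refl
  ... | false = refl

point : ∀ {n} → SElem n → ℕ → SElem n → ℕ
point c v x = if does (x ≟ₛ c) then v else 0

ΣS-point-mass : ∀ {n} (c : SElem n) v → ΣS (point c v) ≡ v
ΣS-point-mass c v = trans (ΣS-point c off-c) at-c
  where
  off-c : ∀ x → x ≢ c → point c v x ≡ 0
  off-c x x≢c with x ≟ₛ c
  ... | yes x≡c = ⊥-elim (x≢c x≡c)
  ... | no _ = refl
  at-c : point c v c ≡ v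
  at-c with c ≟ₛ c
  ... | yes _ = refl
  ... | no c≢c = ⊥-elim (c≢c refl)

outside-uncons : ∀ {n} {L : List (SElem n)} {c} G → (c ∈ᵇ L) ≡ false →
  ∀ r → outside L G r ≡ outside (c ∷ L) G r + point c (G c) r
outside-uncons {c = c} G c∉L r with r ≟ₛ c
... | yes refl rewrite c∉L = refl
... | no _ = sym (ℕ.+-identityʳ _)

ΣS-split : ∀ {n} {L : List (SElem n)} → Unique L → ∀ G → ΣS G ≡ ΣS (outside L G) + sumL G L
ΣS-split [] G = sym (ℕ.+-identityʳ _)
ΣS-split {L = c ∷ L} (c∉L ∷ uniq) G = begin
  ΣS G                                         ≡⟨ ΣS-split uniq G ⟩
  ΣS (outside L G) + sumL G L                  ≡⟨ cong (_+ sumL G L) split-c ⟩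
  (ΣS (outside (c ∷ L) G) + G c) + sumL G L    ≡⟨ ℕ.+-assoc (ΣS (outside (c ∷ L) G)) (G c) (sumL G L) ⟩
  ΣS (outside (c ∷ L) G) + sumL G (c ∷ L)      ∎
  where
  open ≡-Reasoning
  split-c : ΣS (outside L G) ≡ ΣS (outside (c ∷ L) G) + G c
  split-c = begin
    ΣS (outside L G)                                            ≡⟨ ΣS-cong (outside-uncons {L = L} {c} G (All≢⇒∉ᵇ c∉L)) ⟩
    ΣS (λ r → outside (c ∷ L) G r + point c (G c) r)            ≡⟨ ΣS-+ (outside (c ∷ L) G) (point c (G c)) ⟩
    ΣS (outside (c ∷ L) G) + ΣS (point c (G c))                 ≡⟨ cong (ΣS (outside (c ∷ L) G) +_) (ΣS-point-mass c (G c)) ⟩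
    ΣS (outside (c ∷ L) G) + G c                                ∎

sumL-ΣS-comm : ∀ {n} (H : SElem n → SElem n → ℕ) (L : List (SElem n)) →
  sumL (λ c → ΣS (H c)) L ≡ ΣS (λ s → sumL (λ c → H c s) L)
sumL-ΣS-comm {n} H [] = sym (ΣS-zero {n} (λ _ → refl))
sumL-ΣS-comm H (c ∷ L) =
  trans (cong (ΣS (H c) +_) (sumL-ΣS-comm H L)) (sym (ΣS-+ (H c) (λ s → sumL (λ c′ → H c′ s) L)))

sumL-outside : ∀ {n} (L : List (SElem n)) (H : SElem n → SElem n → ℕ) s →
  sumL (λ c → outside L (H c) s) L ≡ outside L (λ s′ → sumL (λ c → H c s′) L) s
sumL-outside L H s with s ∈ᵇ L
... | true = sumL-0 L
  where
  sumL-0 : ∀ M → sumL (λ _ → 0) M ≡ 0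
  sumL-0 [] = refl
  sumL-0 (_ ∷ M) = sumL-0 M
... | false = refl

ΣS²-split : ∀ {n} {L : List (SElem n)} → Unique L → (F : SElem n → SElem n → ℕ) →
  ΣS (λ r → ΣS (F r)) ≡
    (ΣS (outside L (λ r → ΣS (outside L (F r))))
     + ΣS (outside L (λ r → sumL (F r) L + sumL (λ c → F c r) L)))
    + sumL (λ c → sumL (F c) L) L
ΣS²-split {L = L} uniq F = begin
  ΣS (λ r → ΣS (F r))                                      ≡⟨ ΣS-cong (λ r → ΣS-split uniq (F r)) ⟩
  ΣS (λ r → A r + B r)                                     ≡⟨ ΣS-+ A B ⟩
  ΣS A + ΣS B                                              ≡⟨ cong₂ _+_ (ΣS-split uniq A) (ΣS-split uniq B) ⟩
  (ΣS (outside L A) + sumL A L) + (ΣS (outside L B) + sumL B L)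
      ≡⟨ cong (λ t → (ΣS (outside L A) + t) + (ΣS (outside L B) + sumL B L)) A-on-L ⟩
  (ΣS (outside L A) + ΣS (outside L C)) + (ΣS (outside L B) + sumL B L)
      ≡⟨ regroup (ΣS (outside L A)) (ΣS (outside L C)) (ΣS (outside L B)) (sumL B L) ⟩
  (ΣS (outside L A) + (ΣS (outside L B) + ΣS (outside L C))) + sumL B L
                                                           ≡⟨ cong (λ t → (ΣS (outside L A) + t) + sumL B L) B+C ⟩
  (ΣS (outside L A) + ΣS (outside L (λ r → B r + C r))) + sumL B L ∎
  where
  open ≡-Reasoning
  A B C : SElem _ → ℕ
  A r = ΣS (outside L (F r))
  B r = sumL (F r) L
  C s = sumL (λ c → F c s) L
  A-on-L : sumL A L ≡ ΣS (outside L C)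
  A-on-L = trans (sumL-ΣS-comm (λ c → outside L (F c)) L) (ΣS-cong (sumL-outside L F))
  B+C : ΣS (outside L B) + ΣS (outside L C) ≡ ΣS (outside L (λ r → B r + C r))
  B+C = trans (sym (ΣS-+ (outside L B) (outside L C))) (ΣS-cong (outside-+ L B C))
  regroup : ∀ a c b e → (a + c) + (b + e) ≡ (a + (b + c)) + e
  regroup = solve-∀

-- Transpositions

neg-involutive : ∀ {n} (x : SElem n) → neg (neg x) ≡ x
neg-involutive (s , i) = cong (_, i) (not-involutive s)

neg-injective : ∀ {n} {x y : SElem n} → neg x ≡ neg y → x ≡ y
neg-injective {x = x} {y} -x≡-y = trans (sym (neg-involutive x)) (trans (cong neg -x≡-y) (neg-involutive y))

neg-≢ : ∀ {n} (x : SElem n) → neg x ≢ x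
neg-≢ (false , _) ()
neg-≢ (true , _) ()

≢-neg : ∀ {n} {x y : SElem n} → x ≢ neg y → neg x ≢ y
≢-neg {x = x} x≢-y -x≡y = x≢-y (trans (sym (neg-involutive x)) (cong neg -x≡y))

neg-≢-neg : ∀ {n} {x y : SElem n} → x ≢ y → neg x ≢ neg y
neg-≢-neg x≢y = x≢y ∘ neg-injective

transp-at-x : ∀ {n} (x y : SElem n) → transp x y x ≡ y
transp-at-x x y with x ≟ₛ x
... | yes _ = refl
... | no x≢x = ⊥-elim (x≢x refl)

transp-at-y : ∀ {n} (x y : SElem n) → transp x y y ≡ x
transp-at-y x y with y ≟ₛ x
... | yes y≡x = y≡x
... | no _ with y ≟ₛ y
...   | yes _ = refl
...   | no y≢y = ⊥-elim (y≢y refl)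

transp-elsewhere : ∀ {n} {x y z : SElem n} → z ≢ x → z ≢ y → transp x y z ≡ z
transp-elsewhere {x = x} {y} {z} z≢x z≢y with z ≟ₛ x
... | yes z≡x = ⊥-elim (z≢x z≡x)
... | no _ with z ≟ₛ y
...   | yes z≡y = ⊥-elim (z≢y z≡y)
...   | no _ = refl

module SignFlip {n} (a : SElem n) where

  at-a : transp a (neg a) a ≡ neg a
  at-a = transp-at-x a (neg a)

  at-neg-a : transp a (neg a) (neg a) ≡ a
  at-neg-a = transp-at-y a (neg a)

  elsewhere : ∀ {z} → z ≢ a → z ≢ neg a → transp a (neg a) z ≡ z
  elsewhere = transp-elsewhere

  data View : SElem n → Set where
    is-a : View a
    is-neg-a : View (neg a)
    other : ∀ {z} → z ≢ a → z ≢ neg a → View z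

  view : ∀ z → View z
  view z with z ≟ₛ a
  ... | yes refl = is-a
  ... | no z≢a with z ≟ₛ neg a
  ...   | yes refl = is-neg-a
  ...   | no z≢-a = other z≢a z≢-a

  involutive : ∀ z → transp a (neg a) (transp a (neg a) z) ≡ z
  involutive z with view z
  ... | is-a = trans (cong (transp a (neg a)) at-a) at-neg-a
  ... | is-neg-a = trans (cong (transp a (neg a)) at-neg-a) at-a
  ... | other z≢a z≢-a = trans (cong (transp a (neg a)) (elsewhere z≢a z≢-a)) (elsewhere z≢a z≢-a)

  neg-commute : ∀ z → transp a (neg a) (neg z) ≡ neg (transp a (neg a) z)
  neg-commute z with view z
  ... | is-a = trans at-neg-a (trans (sym (neg-involutive a)) (cong neg (sym at-a)))
  ... | is-neg-a = trans (cong (transp a (neg a)) (neg-involutive a)) (trans at-a (cong neg (sym at-neg-a)))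
  ... | other z≢a z≢-a =
    trans (elsewhere (≢-neg z≢-a) (neg-≢-neg z≢a))
          (cong neg (sym (elsewhere z≢a z≢-a)))

-- t_{a,b} t_{-a,-b}, which is u_{a,b} for a ≠ -b; s_i is the case a = i, b = i + 1
pairSwap : ∀ {n} → SElem n → SElem n → SElem n → SElem n
pairSwap a b = transp a b ∘ transp (neg a) (neg b)

module PairSwap {n} {a b : SElem n} (a≢b : a ≢ b) (a≢-b : a ≢ neg b) where

  private
    -a≢b : neg a ≢ b
    -a≢b = ≢-neg a≢-b
    b≢-a : b ≢ neg a
    b≢-a = -a≢b ∘ sym

  at-a : pairSwap a b a ≡ b
  at-a = trans (cong (transp a b) (transp-elsewhere (neg-≢ a ∘ sym) a≢-b)) (transp-at-x a b)

  at-b : pairSwap a b b ≡ a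
  at-b = trans (cong (transp a b) (transp-elsewhere b≢-a (neg-≢ b ∘ sym))) (transp-at-y a b)

  at-neg-a : pairSwap a b (neg a) ≡ neg b
  at-neg-a = trans (cong (transp a b) (transp-at-x (neg a) (neg b))) (transp-elsewhere (a≢-b ∘ sym) (neg-≢ b))

  at-neg-b : pairSwap a b (neg b) ≡ neg a
  at-neg-b = trans (cong (transp a b) (transp-at-y (neg a) (neg b))) (transp-elsewhere (neg-≢ a) -a≢b)

  elsewhere : ∀ {z} → z ≢ a → z ≢ b → z ≢ neg a → z ≢ neg b → pairSwap a b z ≡ z
  elsewhere z≢a z≢b z≢-a z≢-b = trans (cong (transp a b) (transp-elsewhere z≢-a z≢-b)) (transp-elsewhere z≢a z≢b)

  data View : SElem n → Set where
    is-a : View a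
    is-b : View b
    is-neg-a : View (neg a)
    is-neg-b : View (neg b)
    other : ∀ {z} → z ≢ a → z ≢ b → z ≢ neg a → z ≢ neg b → View z

  view : ∀ z → View z
  view z with z ≟ₛ a
  ... | yes refl = is-a
  ... | no z≢a with z ≟ₛ b
  ...   | yes refl = is-b
  ...   | no z≢b with z ≟ₛ neg a
  ...     | yes refl = is-neg-a
  ...     | no z≢-a with z ≟ₛ neg b
  ...       | yes refl = is-neg-b
  ...       | no z≢-b = other z≢a z≢b z≢-a z≢-b

  involutive : ∀ z → pairSwap a b (pairSwap a b z) ≡ z
  involutive z with view z
  ... | is-a = trans (cong (pairSwap a b) at-a) at-b
  ... | is-b = trans (cong (pairSwap a b) at-b) at-a
  ... | is-neg-a = trans (cong (pairSwap a b) at-neg-a) at-neg-b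
  ... | is-neg-b = trans (cong (pairSwap a b) at-neg-b) at-neg-a
  ... | other z≢a z≢b z≢-a z≢-b =
    trans (cong (pairSwap a b) (elsewhere z≢a z≢b z≢-a z≢-b)) (elsewhere z≢a z≢b z≢-a z≢-b)

  neg-commute : ∀ z → pairSwap a b (neg z) ≡ neg (pairSwap a b z)
  neg-commute z with view z
  ... | is-a = trans at-neg-a (cong neg (sym at-a))
  ... | is-b = trans at-neg-b (cong neg (sym at-b))
  ... | is-neg-a = trans (cong (pairSwap a b) (neg-involutive a))
                         (trans at-a (trans (sym (neg-involutive b)) (cong neg (sym at-neg-a))))
  ... | is-neg-b = trans (cong (pairSwap a b) (neg-involutive b))
                         (trans at-b (trans (sym (neg-involutive a)) (cong neg (sym at-neg-b))))
  ... | other z≢a z≢b z≢-a z≢-b =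
    trans (elsewhere (≢-neg z≢-a) (≢-neg z≢-b) (neg-≢-neg z≢a) (neg-≢-neg z≢b))
          (cong neg (sym (elsewhere z≢a z≢b z≢-a z≢-b)))

module _ {n} {a b : SElem n} (a≢b : a ≢ b) (a≢-b : a ≢ neg b) where
  private
    module ab = PairSwap a≢b a≢-b
    module ba = PairSwap (a≢b ∘ sym) (≢-neg a≢-b ∘ sym)

  pairSwap-comm : ∀ z → pairSwap a b z ≡ pairSwap b a z
  pairSwap-comm z with ab.view z
  ... | ab.is-a = trans ab.at-a (sym ba.at-b)
  ... | ab.is-b = trans ab.at-b (sym ba.at-a)
  ... | ab.is-neg-a = trans ab.at-neg-a (sym ba.at-neg-b)
  ... | ab.is-neg-b = trans ab.at-neg-b (sym ba.at-neg-a)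
  ... | ab.other z≢a z≢b z≢-a z≢-b =
    trans (ab.elsewhere z≢a z≢b z≢-a z≢-b) (sym (ba.elsewhere z≢b z≢a z≢-b z≢-a))

record IsSignedPerm {n} (g : SElem n → SElem n) : Set where
  field
    inverse : SElem n → SElem n
    inverseˡ : ∀ x → inverse (g x) ≡ x
    inverseʳ : ∀ x → g (inverse x) ≡ x
    neg-commute : ∀ x → g (neg x) ≡ neg (g x)

  inverse-neg-commute : ∀ y → inverse (neg y) ≡ neg (inverse y)
  inverse-neg-commute y =
    trans (cong inverse (trans (cong neg (sym (inverseʳ y))) (sym (neg-commute (inverse y)))))
          (inverseˡ (neg (inverse y)))

  injective : ∀ {x y} → g x ≡ g y → x ≡ y
  injective {x} {y} gx≡gy = trans (sym (inverseˡ x)) (trans (cong inverse gx≡gy) (inverseˡ y))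

  ≢-inverse : ∀ {r v} → r ≢ inverse v → g r ≢ v
  ≢-inverse r≢ gr≡v = r≢ (trans (sym (inverseˡ _)) (cong inverse gr≡v))

  ≢-neg-inverse : ∀ {r v} → r ≢ neg (inverse v) → g r ≢ neg v
  ≢-neg-inverse {v = v} r≢ = ≢-inverse (λ r≡ → r≢ (trans r≡ (inverse-neg-commute v)))

isSignedPerm-cong : ∀ {n} {f g : SElem n → SElem n} → (∀ x → f x ≡ g x) → IsSignedPerm g → IsSignedPerm f
isSignedPerm-cong f≗g sg = record
  { inverse = inverse
  ; inverseˡ = λ x → trans (cong inverse (f≗g x)) (inverseˡ x)
  ; inverseʳ = λ x → trans (f≗g _) (inverseʳ x)
  ; neg-commute = λ x → trans (f≗g (neg x)) (trans (neg-commute x) (cong neg (sym (f≗g x))))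
  }
  where open IsSignedPerm sg

isSignedPerm-id : ∀ {n} → IsSignedPerm {n} id
isSignedPerm-id = record { inverse = id ; inverseˡ = λ _ → refl ; inverseʳ = λ _ → refl ; neg-commute = λ _ → refl }

isSignedPerm-∘ : ∀ {n} {s g : SElem n → SElem n} → (∀ x → s (s x) ≡ x) → (∀ x → s (neg x) ≡ neg (s x)) →
  IsSignedPerm g → IsSignedPerm (s ∘ g)
isSignedPerm-∘ {s = s} {g} s-involutive s-neg sg = record
  { inverse = inverse ∘ s
  ; inverseˡ = λ x → trans (cong inverse (s-involutive (g x))) (inverseˡ x)
  ; inverseʳ = λ x → trans (cong s (inverseʳ (s x))) (s-involutive x)
  ; neg-commute = λ x → trans (cong s (neg-commute x)) (s-neg (g x))
  }
  where open IsSignedPerm sg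

isSignedPerm-pairSwap : ∀ {n} {a b : SElem n} (a≢b : a ≢ b) (a≢-b : a ≢ neg b) {g : SElem n → SElem n} →
  IsSignedPerm g → IsSignedPerm (pairSwap a b ∘ g)
isSignedPerm-pairSwap a≢b a≢-b = isSignedPerm-∘ (PairSwap.involutive a≢b a≢-b) (PairSwap.neg-commute a≢b a≢-b)

isSignedPerm-BPerm : ∀ {n} (π : BPerm n) → IsSignedPerm (fun π)
isSignedPerm-BPerm π = record { inverse = inv π ; inverseˡ = left π ; inverseʳ = right π ; neg-commute = odd π }

u≗pairSwap : ∀ {n} {x y : SElem n} → x ≢ neg y → ∀ z → u x y z ≡ pairSwap x y z
u≗pairSwap {x = x} {y} x≢-y z with x ≟ₛ neg y
... | yes x≡-y = ⊥-elim (x≢-y x≡-y)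
... | no _ = refl

s-pair-≢ : ∀ {m} (j : Fin m) → pos {suc m} (inject₁ j) ≢ pos (suc j)
s-pair-≢ j e = ℕ.1+n≢n (sym (trans (sym (toℕ-inject₁ j)) (cong (toℕ ∘ proj₂) e)))

s-pair-≢neg : ∀ {m} (j : Fin m) → pos {suc m} (inject₁ j) ≢ neg (pos (suc j))
s-pair-≢neg j ()

gen-involutive : ∀ {n} (k : Fin n) x → gen k (gen k x) ≡ x
gen-involutive {suc m} zero = SignFlip.involutive (pos zero)
gen-involutive {suc m} (suc j) = PairSwap.involutive (s-pair-≢ j) (s-pair-≢neg j)

gen-neg-commute : ∀ {n} (k : Fin n) x → gen k (neg x) ≡ neg (gen k x)
gen-neg-commute {suc m} zero = SignFlip.neg-commute (pos zero)
gen-neg-commute {suc m} (suc j) = PairSwap.neg-commute (s-pair-≢ j) (s-pair-≢neg j)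

isSignedPerm-evalW : ∀ {n} (w : List (Fin n)) → IsSignedPerm (evalW w)
isSignedPerm-evalW [] = isSignedPerm-id
isSignedPerm-evalW (k ∷ w) = isSignedPerm-∘ (gen-involutive k) (gen-neg-commute k) (isSignedPerm-evalW w)

iverson : Bool → ℕ
iverson b = if b then 1 else 0

invAt : ∀ {n} (r s vr vs : SElem n) → ℕ
invAt r s vr vs = if r <ₛ s then iverson (vs <ₛ vr) else 0

inversion : ∀ {n} → (SElem n → SElem n) → SElem n → SElem n → ℕ
inversion f r s = invAt r s (f r) (f s)

negAt : ∀ {n} (r v : SElem n) → ℕ
negAt r v = if sign r then 0 else iverson (sign v)

negation : ∀ {n} → (SElem n → SElem n) → SElem n → ℕ
negation f r = negAt r (f r)

-- D f = inv f + neg f, which turns out to be 2 ℓ(f)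
D : ∀ {n} → (SElem n → SElem n) → ℕ
D f = ΣS (λ r → ΣS (inversion f r)) + ΣS (negation f)

D-cong : ∀ {n} {f g : SElem n → SElem n} → (∀ x → f x ≡ g x) → D f ≡ D g
D-cong f≗g = cong₂ _+_ (ΣS-cong λ r → ΣS-cong λ s → cong₂ (invAt r s) (f≗g r) (f≗g s))
                       (ΣS-cong λ r → cong (negAt r) (f≗g r))

D-id : ∀ {n} → D {n} id ≡ 0
D-id {n} = cong₂ _+_ (ΣS-zero {n} λ r → ΣS-zero {n} (no-inversion r)) (ΣS-zero {n} no-negation)
  where
  no-inversion : ∀ (r s : SElem n) → inversion id r s ≡ 0
  no-inversion r s with r <ₛ s in r<s
  ... | true rewrite <ₛ-asym r s r<s = refl
  ... | false = refl
  no-negation : ∀ (r : SElem n) → negation id r ≡ 0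
  no-negation (false , _) = refl
  no-negation (true , _) = refl

Graph : ℕ → Set
Graph n = List (SElem n × SElem n)

graphOn : ∀ {n} → (SElem n → SElem n) → List (SElem n) → Graph n
graphOn h = map (λ c → c , h c)

-- The part of D carried by the pairs of points of a finite graph
innerD : ∀ {n} → Graph n → ℕ
innerD G = sumL (λ p → sumL (λ q → invAt (proj₁ p) (proj₁ q) (proj₂ p) (proj₂ q)) G) G
         + sumL (λ p → negAt (proj₁ p) (proj₂ p)) G

innerD-graphOn : ∀ {n} (h : SElem n → SElem n) L →
  innerD (graphOn h L) ≡ sumL (λ c → sumL (inversion h c) L) L + sumL (negation h) L
innerD-graphOn h L = cong₂ _+_
  (trans (sumL-map _ _ L) (sumL-cong (All.universal (λ c → sumL-map _ _ L) L)))
  (sumL-map _ _ L)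

cross : ∀ {n} → List (SElem n) → (SElem n → SElem n) → SElem n → ℕ
cross L h r = sumL (inversion h r) L + sumL (λ c → inversion h c r) L

record SameSide {n} (v v′ w : SElem n) : Set where
  constructor sameSide
  field
    below : (v <ₛ w) ≡ (v′ <ₛ w)
    above : (w <ₛ v) ≡ (w <ₛ v′)

SameSide-sym : ∀ {n} {v v′ w : SElem n} → SameSide v v′ w → SameSide v′ v w
SameSide-sym (sameSide v<w w<v) = sameSide (sym v<w) (sym w<v)

cross-sameSide : ∀ {n} L {f g : SElem n → SElem n} r → f r ≡ g r →
  All (λ c → SameSide (f c) (g c) (g r)) L → cross L f r ≡ cross L g r
cross-sameSide L {f} {g} r fr≡gr sides = cong₂ _+_
  (sumL-cong (All.map (λ { {c} (sameSide v<w _) → cong (λ b → if r <ₛ c then iverson b else 0)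
                                                    (trans (cong (f c <ₛ_) fr≡gr) v<w) }) sides))
  (sumL-cong (All.map (λ { {c} (sameSide _ w<v) → cong (λ b → if c <ₛ r then iverson b else 0)
                                                    (trans (cong (_<ₛ f c) fr≡gr) w<v) }) sides))

module LocalChange {n} {L : List (SElem n)} (uniq : Unique L) (f g : SElem n → SElem n) where

  private
    offL : (SElem n → SElem n) → ℕ
    offL h = ΣS (outside L (λ r → ΣS (outside L (inversion h r)))) + ΣS (outside L (negation h))

    crossSum : (SElem n → SElem n) → ℕ
    crossSum h = ΣS (outside L (cross L h))

    D-split : ∀ h → D h ≡ (offL h + crossSum h) + innerD (graphOn h L)
    D-split h = begin
      D h
        ≡⟨ cong₂ _+_ (ΣS²-split uniq (inversion h)) (ΣS-split uniq (negation h)) ⟩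
      ((far + crossSum h) + onL) + (farNeg + onLNeg)
        ≡⟨ regroup far (crossSum h) onL farNeg onLNeg ⟩
      ((far + farNeg) + crossSum h) + (onL + onLNeg)
        ≡⟨ cong (offL h + crossSum h +_) (sym (innerD-graphOn h L)) ⟩
      (offL h + crossSum h) + innerD (graphOn h L) ∎
      where
      open ≡-Reasoning
      far farNeg onL onLNeg : ℕ
      far = ΣS (outside L (λ r → ΣS (outside L (inversion h r))))
      farNeg = ΣS (outside L (negation h))
      onL = sumL (λ c → sumL (inversion h c) L) L
      onLNeg = sumL (negation h) L
      regroup : ∀ a c e a′ e′ → ((a + c) + e) + (a′ + e′) ≡ ((a + a′) + c) + (e + e′)
      regroup = solve-∀

  D-compare : (B : SElem n → ℕ) →
    (∀ r → (r ∈ᵇ L) ≡ false → f r ≡ g r) →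
    (∀ r → (r ∈ᵇ L) ≡ false → cross L f r + B r ≡ cross L g r) →
    D f + ΣS (outside L B) + innerD (graphOn g L) ≡ D g + innerD (graphOn f L)
  D-compare B f≗g cross-change = begin
    D f + ΣS (outside L B) + onL g
      ≡⟨ cong (λ t → t + ΣS (outside L B) + onL g) (D-split f) ⟩
    (offL f + crossSum f) + onL f + ΣS (outside L B) + onL g
      ≡⟨ regroup (offL f) (crossSum f) (onL f) (ΣS (outside L B)) (onL g) ⟩
    (offL f + (crossSum f + ΣS (outside L B))) + onL g + onL f
      ≡⟨ cong₂ (λ a b → (a + b) + onL g + onL f) offL-same crossSum-change ⟩
    (offL g + crossSum g) + onL g + onL f
      ≡⟨ cong (_+ onL f) (sym (D-split g)) ⟩
    D g + onL f ∎
    where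
    open ≡-Reasoning
    onL : (SElem n → SElem n) → ℕ
    onL h = innerD (graphOn h L)
    regroup : ∀ a c e b e′ → (a + c) + e + b + e′ ≡ (a + (c + b)) + e′ + e
    regroup = solve-∀
    offL-same : offL f ≡ offL g
    offL-same = cong₂ _+_
      (ΣS-cong (outside-cong L λ r r∉ → ΣS-cong (outside-cong L λ s s∉ → cong₂ (invAt r s) (f≗g r r∉) (f≗g s s∉))))
      (ΣS-cong (outside-cong L λ r r∉ → cong (negAt r) (f≗g r r∉)))
    crossSum-change : crossSum f + ΣS (outside L B) ≡ crossSum g
    crossSum-change = trans (sym (ΣS-+ (outside L (cross L f)) (outside L B)))
                            (ΣS-cong λ r → trans (outside-+ L (cross L f) B r) (outside-cong L cross-change r))

  D-compare-same-cross :
    (∀ r → (r ∈ᵇ L) ≡ false → f r ≡ g r) →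
    (∀ r → (r ∈ᵇ L) ≡ false → cross L f r ≡ cross L g r) →
    D f + innerD (graphOn g L) ≡ D g + innerD (graphOn f L)
  D-compare-same-cross f≗g same-cross = begin
    D f + innerD (graphOn g L)                            ≡⟨ cong (λ t → t + innerD (graphOn g L)) no-extra ⟩
    D f + ΣS (outside L (λ _ → 0)) + innerD (graphOn g L)
      ≡⟨ D-compare (λ _ → 0) f≗g (λ r r∉ → trans (ℕ.+-identityʳ _) (same-cross r r∉)) ⟩
    D g + innerD (graphOn f L)                            ∎
    where
    open ≡-Reasoning
    no-extra : D f ≡ D f + ΣS (outside L (λ _ → 0))
    no-extra = trans (sym (ℕ.+-identityʳ (D f))) (cong (D f +_) (sym (ΣS-outside-0 L)))

difference-transfer : ∀ d d′ a a′ b b′ → d + a ≡ d′ + a′ → a + b ≡ a′ + b′ → d + b′ ≡ d′ + b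
difference-transfer d d′ a a′ b b′ e₁ e₂ = ℕ.+-cancelʳ-≡ a′ (d + b′) (d′ + b) (begin
  d + b′ + a′      ≡⟨ rearrangeˡ d b′ a′ ⟩
  d + (a′ + b′)    ≡⟨ cong (d +_) (sym e₂) ⟩
  d + (a + b)      ≡⟨ sym (ℕ.+-assoc d a b) ⟩
  d + a + b        ≡⟨ cong (_+ b) e₁ ⟩
  d′ + a′ + b      ≡⟨ rearrangeʳ d′ a′ b ⟩
  d′ + b + a′      ∎)
  where
  open ≡-Reasoning
  rearrangeˡ : ∀ d b′ a′ → d + b′ + a′ ≡ d + (a′ + b′)
  rearrangeˡ = solve-∀
  rearrangeʳ : ∀ d′ a′ b → d′ + a′ + b ≡ d′ + b + a′
  rearrangeʳ = solve-∀

≢-from-images : ∀ {n} {g : SElem n → SElem n} {a b va vb : SElem n} → g a ≡ va → g b ≡ vb → va ≢ vb → a ≢ b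
≢-from-images ga≡va gb≡vb va≢vb refl = va≢vb (trans (sym ga≡va) gb≡vb)

index-≢ : ∀ {n} {x y : SElem n} → x ≢ y → x ≢ neg y → proj₂ x ≢ proj₂ y
index-≢ {x = false , i} {false , .i} x≢y _ refl = x≢y refl
index-≢ {x = false , i} {true , .i} _ x≢-y refl = x≢-y refl
index-≢ {x = true , i} {false , .i} _ x≢-y refl = x≢-y refl
index-≢ {x = true , i} {true , .i} x≢y _ refl = x≢y refl

-- Each generator changes D by ±2

-- s_i exchanges two values that are adjacent in the order, so only the inversions between
-- positions in L, the preimages of the moved values, can change.

sameSide-±1 : ∀ {m} {w : SElem (suc m)} → w ≢ pos zero → w ≢ neg (pos zero) →
  SameSide (pos zero) (neg (pos zero)) w
sameSide-±1 {w = false , zero} w≢1 _ = ⊥-elim (w≢1 refl)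
sameSide-±1 {w = false , suc _} _ _ = sameSide refl refl
sameSide-±1 {w = true , zero} _ w≢-1 = ⊥-elim (w≢-1 refl)
sameSide-±1 {w = true , suc _} _ _ = sameSide refl refl

innerD-±1 : ∀ {m} (P : SElem (suc m)) →
  innerD ((P , pos zero) ∷ (neg P , neg (pos zero)) ∷ []) ≡ 2 * iverson (sign P)
innerD-±1 (false , i) rewrite <ᵇ-irrefl (toℕ i) = refl
innerD-±1 (true , i) rewrite <ᵇ-irrefl (toℕ i) = refl

innerD-∓1 : ∀ {m} (P : SElem (suc m)) →
  innerD ((P , neg (pos zero)) ∷ (neg P , pos zero) ∷ []) ≡ 2 * iverson (not (sign P))
innerD-∓1 (false , i) rewrite <ᵇ-irrefl (toℕ i) = refl
innerD-∓1 (true , i) rewrite <ᵇ-irrefl (toℕ i) = refl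

module Generator₀ {m} {g : SElem (suc m) → SElem (suc m)} (sg : IsSignedPerm g) where
  open IsSignedPerm sg

  P : SElem (suc m)
  P = inverse (pos zero)

  L : List (SElem (suc m))
  L = P ∷ neg P ∷ []

  f : SElem (suc m) → SElem (suc m)
  f = gen zero ∘ g

  g-P : g P ≡ pos zero
  g-P = inverseʳ (pos zero)

  g-negP : g (neg P) ≡ neg (pos zero)
  g-negP = trans (neg-commute P) (cong neg g-P)

  f-P : f P ≡ neg (pos zero)
  f-P = trans (cong (gen zero) g-P) (SignFlip.at-a (pos zero))

  f-negP : f (neg P) ≡ pos zero
  f-negP = trans (cong (gen zero) g-negP) (SignFlip.at-neg-a (pos zero))

  uniq : Unique L
  uniq = ((neg-≢ P ∘ sym) ∷ []) ∷ [] ∷ []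

  module _ (r : SElem (suc m)) (r∉L : (r ∈ᵇ L) ≡ false) where
    private
      r≢L : All (r ≢_) L
      r≢L = ∉ᵇ⇒All≢ L r∉L
      gr≢1 : g r ≢ pos zero
      gr≢1 = ≢-inverse (All.lookup r≢L (here refl))
      gr≢-1 : g r ≢ neg (pos zero)
      gr≢-1 = ≢-neg-inverse (All.lookup r≢L (there (here refl)))

    f≡g-off : f r ≡ g r
    f≡g-off = SignFlip.elsewhere (pos zero) gr≢1 gr≢-1

    cross-unchanged : cross L f r ≡ cross L g r
    cross-unchanged = cross-sameSide L {f} {g} r f≡g-off
      (subst₂ (λ a b → SameSide a b (g r)) (sym f-P) (sym g-P) (SameSide-sym (sameSide-±1 gr≢1 gr≢-1))
       ∷ subst₂ (λ a b → SameSide a b (g r)) (sym f-negP) (sym g-negP) (sameSide-±1 gr≢1 gr≢-1)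
       ∷ [])

  D-change : D f + 2 * iverson (sign P) ≡ D g + 2 * iverson (not (sign P))
  D-change = begin
    D f + 2 * iverson (sign P)       ≡⟨ cong (D f +_) innerD-g ⟨
    D f + innerD (graphOn g L)       ≡⟨ LocalChange.D-compare-same-cross uniq f g f≡g-off cross-unchanged ⟩
    D g + innerD (graphOn f L)       ≡⟨ cong (D g +_) innerD-f ⟩
    D g + 2 * iverson (not (sign P)) ∎
    where
    open ≡-Reasoning
    innerD-g : innerD (graphOn g L) ≡ 2 * iverson (sign P)
    innerD-g = trans (cong₂ (λ a b → innerD ((P , a) ∷ (neg P , b) ∷ [])) g-P g-negP) (innerD-±1 P)
    innerD-f : innerD (graphOn f L) ≡ 2 * iverson (not (sign P))
    innerD-f = trans (cong₂ (λ a b → innerD ((P , a) ∷ (neg P , b) ∷ [])) f-P f-negP) (innerD-∓1 P)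

graph₄ : ∀ {n} (P Q a b c d : SElem n) → Graph n
graph₄ P Q a b c d = (P , a) ∷ (Q , b) ∷ (neg P , c) ∷ (neg Q , d) ∷ []

graph₄-cong : ∀ {n} {P Q a b c d a′ b′ c′ d′ : SElem n} → a ≡ a′ → b ≡ b′ → c ≡ c′ → d ≡ d′ →
  graph₄ P Q a b c d ≡ graph₄ P Q a′ b′ c′ d′
graph₄-cong refl refl refl refl = refl

module _ {m} (j : Fin m) where
  private
    x z : SElem (suc m)
    x = pos (inject₁ j)
    z = pos (suc j)

    inject₁-adjacent : ∀ t → t ≢ toℕ j → t ≢ suc (toℕ j) →
      ((toℕ (inject₁ j) <ᵇ t) ≡ (suc (toℕ j) <ᵇ t)) × ((t <ᵇ toℕ (inject₁ j)) ≡ (t <ᵇ suc (toℕ j)))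
    inject₁-adjacent t rewrite toℕ-inject₁ j = <ᵇ-adjacent t (toℕ j)

  sameSide-adjacent : ∀ {w} → w ≢ x → w ≢ z → w ≢ neg x → w ≢ neg z →
    SameSide x z w × SameSide (neg x) (neg z) w
  sameSide-adjacent {s , i} w≢x w≢z w≢-x w≢-z with s
  ... | false = let (x<w , w<x) = inject₁-adjacent (toℕ i) (w≢x ∘ index-eq) (w≢z ∘ cong (false ,_) ∘ toℕ-injective)
                in sameSide x<w w<x , sameSide refl refl
    where
    index-eq : toℕ i ≡ toℕ j → (false , i) ≡ x
    index-eq e = cong (false ,_) (toℕ-injective (trans e (sym (toℕ-inject₁ j))))
  ... | true = let (x<w , w<x) = inject₁-adjacent (toℕ i) (w≢-x ∘ index-eq) (w≢-z ∘ cong (true ,_) ∘ toℕ-injective)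
               in sameSide refl refl , sameSide w<x x<w
    where
    index-eq : toℕ i ≡ toℕ j → (true , i) ≡ neg x
    index-eq e = cong (true ,_) (toℕ-injective (trans e (sym (toℕ-inject₁ j))))

  innerD-adjacent-swap : ∀ (P Q : SElem (suc m)) → proj₂ P ≢ proj₂ Q →
    innerD (graph₄ P Q x z (neg x) (neg z)) + 2 * iverson (P <ₛ Q)
    ≡ innerD (graph₄ P Q z x (neg z) (neg x)) + 2 * iverson (Q <ₛ P)
  innerD-adjacent-swap (false , p) (false , q) p≢q
    rewrite toℕ-inject₁ j | <ᵇ-irrefl (toℕ j) | n<ᵇ1+n (toℕ j) | 1+n<ᵇn (toℕ j)
          | <ᵇ-irrefl (toℕ p) | <ᵇ-irrefl (toℕ q) | <ᵇ-flip (toℕ p) (toℕ q) (p≢q ∘ toℕ-injective)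
    with toℕ p <ᵇ toℕ q
  ... | false = refl
  ... | true = refl
  innerD-adjacent-swap (false , p) (true , q) p≢q
    rewrite toℕ-inject₁ j | <ᵇ-irrefl (toℕ j) | n<ᵇ1+n (toℕ j) | 1+n<ᵇn (toℕ j)
          | <ᵇ-irrefl (toℕ p) | <ᵇ-irrefl (toℕ q) | <ᵇ-flip (toℕ p) (toℕ q) (p≢q ∘ toℕ-injective)
    with toℕ p <ᵇ toℕ q
  ... | false = refl
  ... | true = refl
  innerD-adjacent-swap (true , p) (false , q) p≢q
    rewrite toℕ-inject₁ j | <ᵇ-irrefl (toℕ j) | n<ᵇ1+n (toℕ j) | 1+n<ᵇn (toℕ j)
          | <ᵇ-irrefl (toℕ p) | <ᵇ-irrefl (toℕ q) | <ᵇ-flip (toℕ p) (toℕ q) (p≢q ∘ toℕ-injective)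
    with toℕ p <ᵇ toℕ q
  ... | false = refl
  ... | true = refl
  innerD-adjacent-swap (true , p) (true , q) p≢q
    rewrite toℕ-inject₁ j | <ᵇ-irrefl (toℕ j) | n<ᵇ1+n (toℕ j) | 1+n<ᵇn (toℕ j)
          | <ᵇ-irrefl (toℕ p) | <ᵇ-irrefl (toℕ q) | <ᵇ-flip (toℕ p) (toℕ q) (p≢q ∘ toℕ-injective)
    with toℕ p <ᵇ toℕ q
  ... | false = refl
  ... | true = refl

module Generatorₛ {m} (j : Fin m) {g : SElem (suc m) → SElem (suc m)} (sg : IsSignedPerm g) where
  open IsSignedPerm sg

  x z P Q : SElem (suc m)
  x = pos (inject₁ j)
  z = pos (suc j)
  P = inverse x
  Q = inverse z

  L : List (SElem (suc m))
  L = P ∷ Q ∷ neg P ∷ neg Q ∷ []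

  f : SElem (suc m) → SElem (suc m)
  f = gen (suc j) ∘ g

  private
    x≢z : x ≢ z
    x≢z = s-pair-≢ j
    x≢-z : x ≢ neg z
    x≢-z = s-pair-≢neg j
    module swap = PairSwap x≢z x≢-z

  g-P : g P ≡ x
  g-P = inverseʳ x
  g-Q : g Q ≡ z
  g-Q = inverseʳ z
  g-negP : g (neg P) ≡ neg x
  g-negP = trans (neg-commute P) (cong neg g-P)
  g-negQ : g (neg Q) ≡ neg z
  g-negQ = trans (neg-commute Q) (cong neg g-Q)

  f-P : f P ≡ z
  f-P = trans (cong (gen (suc j)) g-P) swap.at-a
  f-Q : f Q ≡ x
  f-Q = trans (cong (gen (suc j)) g-Q) swap.at-b
  f-negP : f (neg P) ≡ neg z
  f-negP = trans (cong (gen (suc j)) g-negP) swap.at-neg-a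
  f-negQ : f (neg Q) ≡ neg x
  f-negQ = trans (cong (gen (suc j)) g-negQ) swap.at-neg-b

  P≢Q : P ≢ Q
  P≢Q = ≢-from-images {g = g} g-P g-Q x≢z

  P≢-Q : P ≢ neg Q
  P≢-Q = ≢-from-images {g = g} g-P g-negQ x≢-z

  uniq : Unique L
  uniq = (P≢Q ∷ ≢-from-images {g = g} g-P g-negP (λ ()) ∷ P≢-Q ∷ [])
       ∷ (≢-from-images {g = g} g-Q g-negP (λ ()) ∷ ≢-from-images {g = g} g-Q g-negQ (λ ()) ∷ [])
       ∷ (neg-≢-neg P≢Q ∷ [])
       ∷ [] ∷ []

  module _ (r : SElem (suc m)) (r∉L : (r ∈ᵇ L) ≡ false) where
    private
      r≢L : All (r ≢_) L
      r≢L = ∉ᵇ⇒All≢ L r∉L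
      gr≢x : g r ≢ x
      gr≢x = ≢-inverse (All.lookup r≢L (here refl))
      gr≢z : g r ≢ z
      gr≢z = ≢-inverse (All.lookup r≢L (there (here refl)))
      gr≢-x : g r ≢ neg x
      gr≢-x = ≢-neg-inverse (All.lookup r≢L (there (there (here refl))))
      gr≢-z : g r ≢ neg z
      gr≢-z = ≢-neg-inverse (All.lookup r≢L (there (there (there (here refl)))))
      sides : SameSide x z (g r) × SameSide (neg x) (neg z) (g r)
      sides = sameSide-adjacent j gr≢x gr≢z gr≢-x gr≢-z

    f≡g-off : f r ≡ g r
    f≡g-off = swap.elsewhere gr≢x gr≢z gr≢-x gr≢-z

    cross-unchanged : cross L f r ≡ cross L g r
    cross-unchanged = cross-sameSide L {f} {g} r f≡g-off
      ( subst₂ (λ a b → SameSide a b (g r)) (sym f-P) (sym g-P) (SameSide-sym (proj₁ sides))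
      ∷ subst₂ (λ a b → SameSide a b (g r)) (sym f-Q) (sym g-Q) (proj₁ sides)
      ∷ subst₂ (λ a b → SameSide a b (g r)) (sym f-negP) (sym g-negP) (SameSide-sym (proj₂ sides))
      ∷ subst₂ (λ a b → SameSide a b (g r)) (sym f-negQ) (sym g-negQ) (proj₂ sides)
      ∷ [])

  D-change : D f + 2 * iverson (Q <ₛ P) ≡ D g + 2 * iverson (P <ₛ Q)
  D-change = difference-transfer (D f) (D g) (innerD (graphOn g L)) (innerD (graphOn f L)) _ _
    (LocalChange.D-compare-same-cross uniq f g f≡g-off cross-unchanged) swapped
    where
    swapped : innerD (graphOn g L) + 2 * iverson (P <ₛ Q) ≡ innerD (graphOn f L) + 2 * iverson (Q <ₛ P)
    swapped = subst₂ (λ G G′ → innerD G + 2 * iverson (P <ₛ Q) ≡ innerD G′ + 2 * iverson (Q <ₛ P))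
      (graph₄-cong {P = P} {Q} (sym g-P) (sym g-Q) (sym g-negP) (sym g-negQ))
      (graph₄-cong {P = P} {Q} (sym f-P) (sym f-Q) (sym f-negP) (sym f-negQ))
      (innerD-adjacent-swap j P Q (index-≢ P≢Q P≢-Q))

-- i is a (left) descent of g: ℓ(s_i g) < ℓ(g)
descent : ∀ {n} (k : Fin n) {g : SElem n → SElem n} → IsSignedPerm g → Bool
descent {suc m} zero sg = sign (IsSignedPerm.inverse sg (pos zero))
descent {suc m} (suc j) sg = inverse (pos (suc j)) <ₛ inverse (pos (inject₁ j))
  where open IsSignedPerm sg

D-gen : ∀ {n} (k : Fin n) {g : SElem n → SElem n} (sg : IsSignedPerm g) →
  D (gen k ∘ g) + 2 * iverson (descent k sg) ≡ D g + 2 * iverson (not (descent k sg))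
D-gen {suc m} zero sg = Generator₀.D-change sg
D-gen {suc m} (suc j) {g} sg =
  trans D-change (cong (λ b → D g + 2 * iverson b) (<ₛ-flip Q P (P≢Q ∘ sym)))
  where open Generatorₛ j sg

D-gen-≤ : ∀ {n} (k : Fin n) {g : SElem n → SElem n} (sg : IsSignedPerm g) → D (gen k ∘ g) ≤ D g + 2
D-gen-≤ k {g} sg = begin
  D (gen k ∘ g)                                     ≤⟨ ℕ.m≤m+n _ _ ⟩
  D (gen k ∘ g) + 2 * iverson (descent k sg)        ≡⟨ D-gen k sg ⟩
  D g + 2 * iverson (not (descent k sg))            ≤⟨ ℕ.+-monoʳ-≤ (D g) (iverson≤1 (not (descent k sg))) ⟩
  D g + 2                                           ∎
  where
  open ℕ.≤-Reasoning
  iverson≤1 : ∀ b → 2 * iverson b ≤ 2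
  iverson≤1 true = ℕ.≤-refl
  iverson≤1 false = z≤n

D-gen-descent : ∀ {n} (k : Fin n) {g : SElem n → SElem n} (sg : IsSignedPerm g) →
  descent k sg ≡ true → D (gen k ∘ g) + 2 ≡ D g
D-gen-descent k {g} sg is-descent = begin
  D (gen k ∘ g) + 2                                 ≡⟨ cong (λ b → D (gen k ∘ g) + 2 * iverson b) (sym is-descent) ⟩
  D (gen k ∘ g) + 2 * iverson (descent k sg)        ≡⟨ D-gen k sg ⟩
  D g + 2 * iverson (not (descent k sg))            ≡⟨ cong (λ b → D g + 2 * iverson (not b)) is-descent ⟩
  D g + 0                                           ≡⟨ ℕ.+-identityʳ (D g) ⟩
  D g                                               ∎
  where open ≡-Reasoning

D-evalW-≤ : ∀ {n} (w : List (Fin n)) → D (evalW w) ≤ 2 * length w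
D-evalW-≤ {n} [] = ℕ.≤-reflexive (D-id {n})
D-evalW-≤ (k ∷ w) = begin
  D (gen k ∘ evalW w)       ≤⟨ D-gen-≤ k (isSignedPerm-evalW w) ⟩
  D (evalW w) + 2           ≤⟨ ℕ.+-monoˡ-≤ 2 (D-evalW-≤ w) ⟩
  2 * length w + 2          ≡⟨ ℕ.+-comm (2 * length w) 2 ⟩
  2 + 2 * length w          ≡⟨ ℕ.*-suc 2 (length w) ⟨
  2 * suc (length w)        ∎
  where open ℕ.≤-Reasoning

-- Without descents, g⁻¹ sends 1 < 2 < … < n to an increasing sequence of positive elements, hence is the identity.
no-descent⇒id : ∀ {n} {g : SElem n → SElem n} (sg : IsSignedPerm g) → (∀ k → descent k sg ≡ false) → ∀ x → g x ≡ x
no-descent⇒id {zero} _ _ (_ , ())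
no-descent⇒id {suc m} {g} sg no-descent = fixes
  where
  open IsSignedPerm sg
  H : Fin (suc m) → SElem (suc m)
  H i = inverse (pos i)

  H-increasing : ∀ j → (H (inject₁ j) <ₛ H (suc j)) ≡ true
  H-increasing j = ≮ₛ⇒>ₛ H≢ (no-descent (suc j))
    where
    H≢ : H (suc j) ≢ H (inject₁ j)
    H≢ e = s-pair-≢ j (sym (trans (sym (inverseʳ _)) (trans (cong g e) (inverseʳ _))))

  H-positive : ∀ i → sign (H i) ≡ false
  H-positive = <-weakInduction (λ i → sign (H i) ≡ false) (no-descent zero)
    (λ j → above-positive (H (inject₁ j)) (H (suc j)) (H-increasing j))
    where
    above-positive : ∀ (a b : SElem (suc m)) → (a <ₛ b) ≡ true → sign a ≡ false → sign b ≡ false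
    above-positive (false , _) (false , _) _ _ = refl

  φ : Fin (suc m) → Fin (suc m)
  φ i = proj₂ (H i)

  H≡pos-φ : ∀ i → H i ≡ pos (φ i)
  H≡pos-φ i with H i | H-positive i
  ... | false , _ | _ = refl

  φ-increasing : ∀ j → toℕ (φ (inject₁ j)) < toℕ (φ (suc j))
  φ-increasing j = <ᵇ-true⇒<
    (subst₂ (λ a b → (a <ₛ b) ≡ true) (H≡pos-φ (inject₁ j)) (H≡pos-φ (suc j)) (H-increasing j))

  φ-≥ : ∀ i → toℕ i ≤ toℕ (φ i)
  φ-≥ = <-weakInduction (λ i → toℕ i ≤ toℕ (φ i)) z≤n
    (λ j i≤φi → ℕ.≤-trans (s≤s (subst (_≤ toℕ (φ (inject₁ j))) (toℕ-inject₁ j) i≤φi)) (φ-increasing j))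

  φ-≤ : ∀ i → toℕ (φ i) ≤ toℕ i
  φ-≤ = >-weakInduction (λ i → toℕ (φ i) ≤ toℕ i)
    (subst (toℕ (φ (fromℕ m)) ≤_) (sym (toℕ-fromℕ m)) (toℕ≤pred[n] (φ (fromℕ m))))
    (λ j φi≤i → subst (toℕ (φ (inject₁ j)) ≤_) (sym (toℕ-inject₁ j))
                      (ℕ.≤-pred (ℕ.≤-trans (φ-increasing j) φi≤i)))

  fixes-pos : ∀ i → g (pos i) ≡ pos i
  fixes-pos i = trans (cong g (sym H≡pos-i)) (inverseʳ (pos i))
    where
    H≡pos-i : H i ≡ pos i
    H≡pos-i = trans (H≡pos-φ i) (cong pos (toℕ-injective (ℕ.≤-antisym (φ-≤ i) (φ-≥ i))))

  fixes : ∀ x → g x ≡ x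
  fixes (false , i) = fixes-pos i
  fixes (true , i) = trans (neg-commute (pos i)) (cong neg (fixes-pos i))

word-of-half-D : ∀ {n} (N : ℕ) {g : SElem n → SElem n} → IsSignedPerm g → D g ≤ N →
  Σ (List (Fin n)) λ w → Represents w g × 2 * length w ≡ D g
word-of-half-D {n} N {g} sg D≤N with any? (λ k → descent k sg ≟ᵇ true)
... | no no-descent = [] , (λ x → sym (g≗id x)) , sym (trans (D-cong g≗id) (D-id {n}))
  where
  g≗id : ∀ x → g x ≡ x
  g≗id = no-descent⇒id sg (λ k → ¬-not (λ e → no-descent (k , e)))
... | yes (k , is-descent) = peel N D≤N
  where
  D-drop : D (gen k ∘ g) + 2 ≡ D g
  D-drop = D-gen-descent k sg is-descent
  peel : ∀ N → D g ≤ N → Σ (List (Fin n)) λ w → Represents w g × 2 * length w ≡ D g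
  peel zero D≤0 with () ← ℕ.≤-trans (ℕ.≤-trans (ℕ.m≤n+m 2 _) (ℕ.≤-reflexive D-drop)) D≤0
  peel (suc N) D≤1+N with word-of-half-D N (isSignedPerm-∘ (gen-involutive k) (gen-neg-commute k) sg) D′≤N
    where
    D′≤N : D (gen k ∘ g) ≤ N
    D′≤N = ℕ.≤-pred (ℕ.<-≤-trans (subst (D (gen k ∘ g) <_) D-drop (ℕ.m<m+n _ (s≤s z≤n))) D≤1+N)
  ... | w , represents , length-w = k ∷ w , represents′ , length′
    where
    represents′ : Represents (k ∷ w) g
    represents′ x = trans (cong (gen k) (represents x)) (gen-involutive k (g x))
    length′ : 2 * suc (length w) ≡ D g
    length′ = trans (ℕ.*-suc 2 (length w)) (trans (ℕ.+-comm 2 _) (trans (cong (_+ 2) length-w) D-drop))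

HasLength⇒D≡2* : ∀ {n} {f : SElem n → SElem n} {k : ℕ} → HasLength f k → D f ≡ 2 * k
HasLength⇒D≡2* {f = f} {k} ((w , length≡k , represents) , minimal) = ℕ.≤-antisym D≤2k 2k≤D
  where
  D≤2k : D f ≤ 2 * k
  D≤2k = ℕ.≤-trans (ℕ.≤-reflexive (D-cong (sym ∘ represents)))
                   (ℕ.≤-trans (D-evalW-≤ w) (ℕ.≤-reflexive (cong (2 *_) length≡k)))
  half-D-word : Σ (List (Fin _)) λ v → Represents v f × 2 * length v ≡ D f
  half-D-word = word-of-half-D (D f) (isSignedPerm-cong (sym ∘ represents) (isSignedPerm-evalW w)) ℕ.≤-refl
  2k≤D : 2 * k ≤ D f
  2k≤D = ℕ.≤-trans (ℕ.*-monoʳ-≤ 2 (minimal (proj₁ half-D-word) (proj₁ (proj₂ half-D-word))))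
                   (ℕ.≤-reflexive (proj₂ (proj₂ half-D-word)))

-- The position of t relative to lo < hi, as the pair (t <ₛ lo , t <ₛ hi)
data Placement : Bool → Bool → Set where
  below : Placement true true
  inside : Placement false true
  above : Placement false false

placement : ∀ {n} {lo hi : SElem n} → (lo <ₛ hi) ≡ true → ∀ t → Placement (t <ₛ lo) (t <ₛ hi)
placement {lo = lo} {hi} lo<hi t with t <ₛ lo in t<lo | t <ₛ hi in t<hi
... | true | true = below
... | false | true = inside
... | false | false = above
... | true | false with () ← trans (sym t<hi) (<ₛ-trans {x = t} {lo} {hi} t<lo lo<hi)

between : ∀ {n} (lo hi t : SElem n) → Bool
between lo hi t = (lo <ₛ t) ∧ (t <ₛ hi)

pairInversion : ∀ {n} (r s w v : SElem n) → ℕ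
pairInversion r s w v = invAt r s w v + invAt s r v w

pairInversion-exchange : ∀ {n} {r s₁ s₂ w v₁ v₂ : SElem n} →
  r ≢ s₁ → r ≢ s₂ → w ≢ v₁ → w ≢ v₂ → (s₂ <ₛ s₁) ≡ true → (v₁ <ₛ v₂) ≡ true →
  (pairInversion r s₁ w v₂ + pairInversion r s₂ w v₁) + 2 * iverson (between s₂ s₁ r ∧ between v₁ v₂ w)
  ≡ pairInversion r s₁ w v₁ + pairInversion r s₂ w v₂
pairInversion-exchange {r = r} {s₁} {s₂} {w} {v₁} {v₂} r≢s₁ r≢s₂ w≢v₁ w≢v₂ s₂<s₁ v₁<v₂
  rewrite <ₛ-flip r s₁ r≢s₁ | <ₛ-flip r s₂ r≢s₂ | <ₛ-flip w v₁ w≢v₁ | <ₛ-flip w v₂ w≢v₂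
  with r <ₛ s₂ | r <ₛ s₁ | placement {lo = s₂} {s₁} s₂<s₁ r
     | w <ₛ v₁ | w <ₛ v₂ | placement {lo = v₁} {v₂} v₁<v₂ w
... | _ | _ | below | _ | _ | below = refl
... | _ | _ | below | _ | _ | inside = refl
... | _ | _ | below | _ | _ | above = refl
... | _ | _ | inside | _ | _ | below = refl
... | _ | _ | inside | _ | _ | inside = refl
... | _ | _ | inside | _ | _ | above = refl
... | _ | _ | above | _ | _ | below = refl
... | _ | _ | above | _ | _ | inside = refl
... | _ | _ | above | _ | _ | above = refl

innerD-exchange : ∀ {n} {p q : Fin n} {x z : SElem n} →
  (toℕ q <ᵇ toℕ p) ≡ true → (x <ₛ z) ≡ true → proj₂ x ≢ proj₂ z →
  innerD (graph₄ (pos p) (pos q) z x (neg z) (neg x)) + 2 ≡ innerD (graph₄ (pos p) (pos q) x z (neg x) (neg z))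
innerD-exchange {p = p} {q} {false , i} {false , k} q<p x<z _
  rewrite q<p | <ᵇ-asym {toℕ q} {toℕ p} q<p | <ᵇ-irrefl (toℕ p) | <ᵇ-irrefl (toℕ q)
        | x<z | <ᵇ-asym {toℕ i} {toℕ k} x<z = refl
innerD-exchange {p = p} {q} {true , i} {true , k} q<p x<z _
  rewrite q<p | <ᵇ-asym {toℕ q} {toℕ p} q<p | <ᵇ-irrefl (toℕ p) | <ᵇ-irrefl (toℕ q)
        | x<z | <ᵇ-asym {toℕ k} {toℕ i} x<z = refl
innerD-exchange {p = p} {q} {true , i} {false , k} q<p _ i≢k
  rewrite q<p | <ᵇ-asym {toℕ q} {toℕ p} q<p | <ᵇ-irrefl (toℕ p) | <ᵇ-irrefl (toℕ q)
        | <ᵇ-flip (toℕ i) (toℕ k) (i≢k ∘ toℕ-injective)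
  with toℕ i <ᵇ toℕ k
... | true = refl
... | false = refl

cross-4 : ∀ {n} (h : SElem n → SElem n) r a b c d →
  cross (a ∷ b ∷ c ∷ d ∷ []) h r
  ≡ (pairInversion r a (h r) (h a) + pairInversion r b (h r) (h b))
    + (pairInversion r c (h r) (h c) + pairInversion r d (h r) (h d))
cross-4 h r a b c d = regroup (inversion h r a) (inversion h r b) (inversion h r c) (inversion h r d)
                              (inversion h a r) (inversion h b r) (inversion h c r) (inversion h d r)
  where
  regroup : ∀ t₁ t₂ t₃ t₄ t₅ t₆ t₇ t₈ →
    (t₁ + (t₂ + (t₃ + (t₄ + 0)))) + (t₅ + (t₆ + (t₇ + (t₈ + 0))))
    ≡ ((t₁ + t₅) + (t₂ + t₆)) + ((t₃ + t₇) + (t₄ + t₈))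
  regroup = solve-∀

-- u_{x,z} g for an inversion Q < P of g, with values x = g P < z = g Q
module SwapInversion {n} {g : SElem n → SElem n} (sg : IsSignedPerm g) {p q : Fin n}
       (Q<P : (pos q <ₛ pos p) ≡ true) (x<z : (g (pos p) <ₛ g (pos q)) ≡ true) where
  open IsSignedPerm sg

  P Q x z : SElem n
  P = pos p
  Q = pos q
  x = g P
  z = g Q

  L : List (SElem n)
  L = P ∷ Q ∷ neg P ∷ neg Q ∷ []

  f : SElem n → SElem n
  f = pairSwap x z ∘ g

  P≢Q : P ≢ Q
  P≢Q = <ₛ⇒≢ Q<P ∘ sym

  x≢z : x ≢ z
  x≢z = <ₛ⇒≢ x<z

  x≢-z : x ≢ neg z
  x≢-z x≡-z with injective (trans x≡-z (sym (neg-commute Q)))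
  ... | ()

  private
    module swap = PairSwap x≢z x≢-z

  g-negP : g (neg P) ≡ neg x
  g-negP = neg-commute P
  g-negQ : g (neg Q) ≡ neg z
  g-negQ = neg-commute Q

  f-P : f P ≡ z
  f-P = swap.at-a
  f-Q : f Q ≡ x
  f-Q = swap.at-b
  f-negP : f (neg P) ≡ neg z
  f-negP = trans (cong (pairSwap x z) g-negP) swap.at-neg-a
  f-negQ : f (neg Q) ≡ neg x
  f-negQ = trans (cong (pairSwap x z) g-negQ) swap.at-neg-b

  uniq : Unique L
  uniq = (P≢Q ∷ (λ ()) ∷ (λ ()) ∷ []) ∷ ((λ ()) ∷ (λ ()) ∷ []) ∷ (neg-≢-neg P≢Q ∷ []) ∷ [] ∷ []

  extra : SElem n → ℕ
  extra r = 2 * iverson (between Q P r ∧ between x z (g r))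
          + 2 * iverson (between (neg P) (neg Q) r ∧ between (neg z) (neg x) (g r))

  module _ (r : SElem n) (r∉L : (r ∈ᵇ L) ≡ false) where
    private
      r≢L : All (r ≢_) L
      r≢L = ∉ᵇ⇒All≢ L r∉L
      r≢P : r ≢ P
      r≢P = All.lookup r≢L (here refl)
      r≢Q : r ≢ Q
      r≢Q = All.lookup r≢L (there (here refl))
      r≢-P : r ≢ neg P
      r≢-P = All.lookup r≢L (there (there (here refl)))
      r≢-Q : r ≢ neg Q
      r≢-Q = All.lookup r≢L (there (there (there (here refl))))
      w : SElem n
      w = g r
      w≢x : w ≢ x
      w≢x = r≢P ∘ injective
      w≢z : w ≢ z
      w≢z = r≢Q ∘ injective
      w≢-x : w ≢ neg x
      w≢-x e = r≢-P (injective (trans e (sym g-negP)))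
      w≢-z : w ≢ neg z
      w≢-z e = r≢-Q (injective (trans e (sym g-negQ)))

    f≡g-off : f r ≡ g r
    f≡g-off = swap.elsewhere w≢x w≢z w≢-x w≢-z

    cross-change : cross L f r + extra r ≡ cross L g r
    cross-change = begin
      cross L f r + extra r
        ≡⟨ cong (_+ extra r) (trans (cross-4 f r P Q (neg P) (neg Q)) (shape-cong f≡g-off f-P f-Q f-negP f-negQ)) ⟩
      shape z x (neg z) (neg x) + extra r
        ≡⟨ regroup (pairInversion r P w z) (pairInversion r Q w x) (pairInversion r (neg P) w (neg z))
                   (pairInversion r (neg Q) w (neg x)) (2 * iverson (between Q P r ∧ between x z w))
                   (2 * iverson (between (neg P) (neg Q) r ∧ between (neg z) (neg x) w)) ⟩
      ((pairInversion r P w z + pairInversion r Q w x) + 2 * iverson (between Q P r ∧ between x z w))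
      + ((pairInversion r (neg Q) w (neg x) + pairInversion r (neg P) w (neg z))
         + 2 * iverson (between (neg P) (neg Q) r ∧ between (neg z) (neg x) w))
        ≡⟨ cong₂ _+_ (pairInversion-exchange r≢P r≢Q w≢x w≢z Q<P x<z)
                     (pairInversion-exchange r≢-Q r≢-P w≢-z w≢-x
                        (trans (<ₛ-neg P Q) Q<P) (trans (<ₛ-neg z x) x<z)) ⟩
      (pairInversion r P w x + pairInversion r Q w z)
      + (pairInversion r (neg Q) w (neg z) + pairInversion r (neg P) w (neg x))
        ≡⟨ cong ((pairInversion r P w x + pairInversion r Q w z) +_)
                (ℕ.+-comm (pairInversion r (neg Q) w (neg z)) (pairInversion r (neg P) w (neg x))) ⟩
      shape x z (neg x) (neg z)
        ≡⟨ sym (trans (cross-4 g r P Q (neg P) (neg Q)) (shape-cong refl refl refl g-negP g-negQ)) ⟩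
      cross L g r ∎
      where
      open ≡-Reasoning
      shape : (a b c d : SElem n) → ℕ
      shape a b c d = (pairInversion r P w a + pairInversion r Q w b) + (pairInversion r (neg P) w c + pairInversion r (neg Q) w d)
      shape-cong : ∀ {w′ a b c d a′ b′ c′ d′} → w′ ≡ w → a ≡ a′ → b ≡ b′ → c ≡ c′ → d ≡ d′ →
        (pairInversion r P w′ a + pairInversion r Q w′ b) + (pairInversion r (neg P) w′ c + pairInversion r (neg Q) w′ d)
        ≡ shape a′ b′ c′ d′
      shape-cong refl refl refl refl refl = refl
      regroup : ∀ a b c d e e′ → ((a + b) + (c + d)) + (e + e′) ≡ ((a + b) + e) + ((d + c) + e′)
      regroup = solve-∀

  D-exchange : D f + ΣS (outside L extra) + 2 ≡ D g
  D-exchange = trans (difference-transfer _ (D g) (innerD (graphOn g L)) (innerD (graphOn f L)) 0 2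
                        (LocalChange.D-compare uniq f g extra f≡g-off cross-change) inner-exchange)
                     (ℕ.+-identityʳ (D g))
    where
    inner-exchange : innerD (graphOn g L) + 0 ≡ innerD (graphOn f L) + 2
    inner-exchange = begin
      innerD (graphOn g L) + 0                 ≡⟨ ℕ.+-identityʳ _ ⟩
      innerD (graphOn g L)                     ≡⟨ cong innerD (graph₄-cong {P = P} {Q} {a = x} {b = z} refl refl g-negP g-negQ) ⟩
      innerD (graph₄ P Q x z (neg x) (neg z))  ≡⟨ innerD-exchange {p = p} {q} {x} {z} Q<P x<z (index-≢ x≢z x≢-z) ⟨
      innerD (graph₄ P Q z x (neg z) (neg x)) + 2
                                               ≡⟨ cong (λ G → innerD G + 2) (graph₄-cong {P = P} {Q} f-P f-Q f-negP f-negQ) ⟨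
      innerD (graphOn f L) + 2                 ∎
      where open ≡-Reasoning

  D-drop : D f + 2 ≤ D g
  D-drop = ℕ.≤-trans (ℕ.+-monoˡ-≤ 2 (ℕ.m≤m+n (D f) _)) (ℕ.≤-reflexive D-exchange)

  D-drop-between : ∀ {i} → (Q <ₛ pos i) ≡ true → (pos i <ₛ P) ≡ true →
    (x <ₛ g (pos i)) ≡ true → (g (pos i) <ₛ z) ≡ true → D f + 4 ≤ D g
  D-drop-between {i} Q<r r<P x<w w<z = begin
    D f + 4                        ≡⟨ ℕ.+-assoc (D f) 2 2 ⟨
    D f + 2 + 2                    ≤⟨ ℕ.+-monoˡ-≤ 2 (ℕ.+-monoʳ-≤ (D f) (ℕ.≤-trans extra-at-r (ΣS-≥ outside-extra (pos i)))) ⟩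
    D f + ΣS (outside L extra) + 2 ≡⟨ D-exchange ⟩
    D g                            ∎
    where
    open ℕ.≤-Reasoning
    outside-extra : SElem n → ℕ
    outside-extra = outside L extra
    r∉L : (pos i ∈ᵇ L) ≡ false
    r∉L = All≢⇒∉ᵇ {L = L} (<ₛ⇒≢ {x = pos i} {P} r<P ∷ <ₛ⇒≢ {x = Q} Q<r ∘ sym ∷ (λ ()) ∷ (λ ()) ∷ [])
    extra-at-r : 2 ≤ outside L extra (pos i)
    extra-at-r rewrite r∉L | Q<r | r<P | x<w | w<z = ℕ.m≤m+n 2 _

-- Edges

Edgeᴰ : ∀ {n} → (SElem n → SElem n) → SElem n → SElem n → Set
Edgeᴰ g x y = D (u x y ∘ g) + 2 ≡ D g

Edge⇒Edgeᴰ : ∀ {n} (π : BPerm n) {x y : SElem n} → Edge π x y → Edgeᴰ (fun π) x y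
Edge⇒Edgeᴰ π {x} {y} (_ , _ , k , ℓπ≡1+k , ℓuπ≡k) = begin
  D (u x y ∘ fun π) + 2   ≡⟨ cong (_+ 2) (HasLength⇒D≡2* ℓuπ≡k) ⟩
  2 * k + 2               ≡⟨ ℕ.+-comm (2 * k) 2 ⟩
  2 + 2 * k               ≡⟨ ℕ.*-suc 2 k ⟨
  2 * suc k               ≡⟨ HasLength⇒D≡2* ℓπ≡1+k ⟨
  D (fun π)               ∎
  where open ≡-Reasoning

Edgeᴰ-sym : ∀ {n} {g : SElem n → SElem n} {x y : SElem n} → x ≢ y → x ≢ neg y → Edgeᴰ g x y → Edgeᴰ g y x
Edgeᴰ-sym {g = g} {x} {y} x≢y x≢-y = trans (cong (_+ 2) (D-cong u-comm))
  where
  u-comm : ∀ t → u y x (g t) ≡ u x y (g t)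
  u-comm t = trans (u≗pairSwap (≢-neg x≢-y ∘ sym) (g t))
                   (trans (sym (pairSwap-comm x≢y x≢-y (g t))) (sym (u≗pairSwap x≢-y (g t))))

module Edges {n} {g : SElem n → SElem n} (sg : IsSignedPerm g) where
  open IsSignedPerm sg

  image-≢-neg : ∀ p q → g (pos p) ≢ neg (g (pos q))
  image-≢-neg p q e with injective (trans e (sym (neg-commute (pos q))))
  ... | ()

  image-≢ : ∀ {p q} → pos p ≢ pos q → g (pos p) ≢ g (pos q)
  image-≢ p≢q = p≢q ∘ injective

  -- Otherwise (q , p) is an inversion of u_{x,z} g, and undoing it gives D g + 2 ≤ D (u_{x,z} g) = D g - 2.
  edge⇒inversion : ∀ p q → (pos q <ₛ pos p) ≡ true → Edgeᴰ g (g (pos p)) (g (pos q)) →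
    (g (pos p) <ₛ g (pos q)) ≡ true
  edge⇒inversion p q Q<P edge with g (pos p) <ₛ g (pos q) in x<z
  ... | true = refl
  ... | false = ⊥-elim (ℕ.m+1+n≰m (D g) (ℕ.≤-trans (ℕ.≤-reflexive (sym (ℕ.+-assoc (D g) 2 2))) D+4≤D))
    where
    x z : SElem n
    x = g (pos p)
    z = g (pos q)
    x≢z : x ≢ z
    x≢z = image-≢ (<ₛ⇒≢ Q<P ∘ sym)
    x≢-z : x ≢ neg z
    x≢-z = image-≢-neg p q
    g′ : SElem n → SElem n
    g′ = u x z ∘ g
    g′≗swap : ∀ t → g′ t ≡ pairSwap x z (g t)
    g′≗swap t = u≗pairSwap x≢-z (g t)
    g′-P : g′ (pos p) ≡ z
    g′-P = trans (g′≗swap (pos p)) (PairSwap.at-a x≢z x≢-z)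
    g′-Q : g′ (pos q) ≡ x
    g′-Q = trans (g′≗swap (pos q)) (PairSwap.at-b x≢z x≢-z)
    sg′ : IsSignedPerm g′
    sg′ = isSignedPerm-cong g′≗swap (isSignedPerm-pairSwap x≢z x≢-z sg)
    module back = SwapInversion sg′ Q<P
      (subst₂ (λ a b → (a <ₛ b) ≡ true) (sym g′-P) (sym g′-Q) (≮ₛ⇒>ₛ x≢z x<z))
    undo : ∀ t → back.f t ≡ g t
    undo t = begin
      pairSwap (g′ (pos p)) (g′ (pos q)) (g′ t)   ≡⟨ cong₂ (λ a b → pairSwap a b (g′ t)) g′-P g′-Q ⟩
      pairSwap z x (g′ t)                         ≡⟨ pairSwap-comm x≢z x≢-z (g′ t) ⟨
      pairSwap x z (g′ t)                         ≡⟨ cong (pairSwap x z) (g′≗swap t) ⟩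
      pairSwap x z (pairSwap x z (g t))           ≡⟨ PairSwap.involutive x≢z x≢-z (g t) ⟩
      g t                                         ∎
      where open ≡-Reasoning
    D+4≤D : D g + 2 + 2 ≤ D g
    D+4≤D = ℕ.≤-trans (ℕ.+-monoˡ-≤ 2 (ℕ.≤-trans (ℕ.≤-reflexive (cong (_+ 2) (sym (D-cong undo)))) back.D-drop))
                        (ℕ.≤-reflexive edge)

  edge⇒position-order : ∀ p q → (g (pos p) <ₛ g (pos q)) ≡ true → Edgeᴰ g (g (pos p)) (g (pos q)) →
    (pos q <ₛ pos p) ≡ true
  edge⇒position-order p q x<z edge with pos p <ₛ pos q in P<Q
  ... | false = ≮ₛ⇒>ₛ (<ₛ⇒≢ x<z ∘ cong g) P<Q
  ... | true with () ← trans (sym (<ₛ-asym (g (pos p)) (g (pos q)) x<z))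
                             (edge⇒inversion q p P<Q (Edgeᴰ-sym {g = g} (<ₛ⇒≢ x<z) (image-≢-neg p q) edge))

  no-sorted-triangle : ∀ p₁ p₂ p₃ → (g (pos p₁) <ₛ g (pos p₂)) ≡ true → (g (pos p₂) <ₛ g (pos p₃)) ≡ true →
    Edgeᴰ g (g (pos p₁)) (g (pos p₂)) → Edgeᴰ g (g (pos p₂)) (g (pos p₃)) → Edgeᴰ g (g (pos p₁)) (g (pos p₃)) → ⊥
  no-sorted-triangle p₁ p₂ p₃ v₁<v₂ v₂<v₃ e₁₂ e₂₃ e₁₃ = 4≰2 (ℕ.+-cancelˡ-≤ (D outer.f) 4 2 (begin
    D outer.f + 4                              ≤⟨ outer.D-drop-between (edge⇒position-order p₂ p₃ v₂<v₃ e₂₃)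
                                                    (edge⇒position-order p₁ p₂ v₁<v₂ e₁₂) v₁<v₂ v₂<v₃ ⟩
    D g                                        ≡⟨ e₁₃ ⟨
    D (u (g (pos p₁)) (g (pos p₃)) ∘ g) + 2    ≡⟨ cong (_+ 2) (D-cong (u≗pairSwap outer.x≢-z ∘ g)) ⟩
    D outer.f + 2                              ∎))
    where
    open ℕ.≤-Reasoning
    v₁<v₃ : (g (pos p₁) <ₛ g (pos p₃)) ≡ true
    v₁<v₃ = <ₛ-trans {x = g (pos p₁)} {g (pos p₂)} {g (pos p₃)} v₁<v₂ v₂<v₃
    module outer = SwapInversion sg (edge⇒position-order p₁ p₃ v₁<v₃ e₁₃) v₁<v₃
    4≰2 : ¬ (4 ≤ 2)
    4≰2 (s≤s (s≤s ()))

  edge-sym : ∀ s t → g (pos s) ≢ g (pos t) → Edgeᴰ g (g (pos s)) (g (pos t)) → Edgeᴰ g (g (pos t)) (g (pos s))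
  edge-sym s t v≢w = Edgeᴰ-sym {g = g} v≢w (image-≢-neg s t)

  no-triangle : ∀ p q r → let a = g (pos p) ; b = g (pos q) ; c = g (pos r) in
    a ≢ b → a ≢ c → b ≢ c → Edgeᴰ g a b → Edgeᴰ g a c → Edgeᴰ g b c → ⊥
  no-triangle p q r a≢b a≢c b≢c eab eac ebc
    with g (pos p) <ₛ g (pos q) in a<b | g (pos q) <ₛ g (pos r) in b<c | g (pos p) <ₛ g (pos r) in a<c
  ... | true | true | _ = no-sorted-triangle p q r a<b b<c eab ebc eac
  ... | true | false | true = no-sorted-triangle p r q a<c (≮ₛ⇒>ₛ b≢c b<c) eac (edge-sym q r b≢c ebc) eab
  ... | true | false | false = no-sorted-triangle r p q (≮ₛ⇒>ₛ a≢c a<c) a<b (edge-sym p r a≢c eac) eab (edge-sym q r b≢c ebc)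
  ... | false | true | true = no-sorted-triangle q p r (≮ₛ⇒>ₛ a≢b a<b) a<c (edge-sym p q a≢b eab) eac ebc
  ... | false | true | false = no-sorted-triangle q r p b<c (≮ₛ⇒>ₛ a≢c a<c) ebc (edge-sym p r a≢c eac) (edge-sym p q a≢b eab)
  ... | false | false | _ = no-sorted-triangle r q p (≮ₛ⇒>ₛ b≢c b<c) (≮ₛ⇒>ₛ a≢b a<b)
                              (edge-sym q r b≢c ebc) (edge-sym p q a≢b eab) (edge-sym p r a≢c eac)

u-defined⇒opposite-signs : ∀ {n} (π : BPerm n) {i j : Fin n} → fun π (pos i) ≢ fun π (pos j) →
  UDefined π (fun π (pos i)) (neg (fun π (pos j))) → sign (fun π (pos i)) ≡ not (sign (fun π (pos j)))
u-defined⇒opposite-signs π a≢b (inj₁ a≡neg-neg-b) = ⊥-elim (a≢b (trans a≡neg-neg-b (neg-involutive _)))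
u-defined⇒opposite-signs π a≢b (inj₂ (inj₁ signs-equal)) = signs-equal
u-defined⇒opposite-signs π {i} {j} _ (inj₂ (inj₂ preimages-same-sign)) with sign-clash
  where
  open IsSignedPerm (isSignedPerm-BPerm π)
  open ≡-Reasoning
  sign-clash : false ≡ true
  sign-clash = begin
    false                                   ≡⟨ cong sign (inverseˡ (pos i)) ⟨
    sign (inverse (fun π (pos i)))          ≡⟨ preimages-same-sign ⟩
    sign (inverse (neg (fun π (pos j))))    ≡⟨ cong sign (trans (inverse-neg-commute _) (cong neg (inverseˡ (pos j)))) ⟩
    true                                    ∎
... | ()

¬pairwise-opposite : ∀ (x y z : Bool) → x ≡ not y → x ≡ not z → y ≡ not z → ⊥
¬pairwise-opposite x y z x≡¬y x≡¬z = not-¬ (not-injective (trans (sym x≡¬y) x≡¬z))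

mainTheorem3 : (n : ℕ) → 1 ≤ n → (π : BPerm n) → (a b c : SElem n)
    → InImage π a → InImage π b → InImage π c
    → a ≢ b → a ≢ c → b ≢ c
    → ¬ (Edge π a b × Edge π a c × Edge π b c)
      × ¬ (Edge π a (neg b) × Edge π a (neg c) × Edge π b (neg c))
mainTheorem3 n _ π _ _ _ (i , refl) (j , refl) (k , refl) a≢b a≢c b≢c =
  (λ (eab , eac , ebc) → no-triangle i j k a≢b a≢c b≢c (Edge⇒Edgeᴰ π eab) (Edge⇒Edgeᴰ π eac) (Edge⇒Edgeᴰ π ebc))
  , λ (eab , eac , ebc) → ¬pairwise-opposite _ _ _
      (opposite eab a≢b) (opposite eac a≢c) (opposite ebc b≢c)
  where
  open Edges (isSignedPerm-BPerm π)
  opposite : ∀ {p q} → Edge π (fun π (pos p)) (neg (fun π (pos q))) → fun π (pos p) ≢ fun π (pos q) →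
    sign (fun π (pos p)) ≡ not (sign (fun π (pos q)))
  opposite e v≢w = u-defined⇒opposite-signs π v≢w (proj₁ (proj₂ e))
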